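{- Let $F_S$, $F_R$, $F_{S\otimes R}$ be functors on the category of sets, with semantic structures $((\Omega_S,\preceq_S),\tau_S)$, $((\Omega_R,\preceq_R),\tau_R)$, $((\Omega_{S\otimes R},\preceq),\tau_{S\otimes R})$ respectively, let $\lambda$ be a distributive law from $F_S$ and $F_R$ to $F_{S\otimes R}$, and let $q\colon\Omega_S\times\Omega_R\to\Omega_{S\otimes R}$. Assume $q(\bot,\bot)=\bot$ and that for all $\omega$-chains $(t_i)_{i\in\mathbb{N}}$ in $\Omega_S$ and $(t'_j)_{j\in\mathbb{N}}$ in $\Omega_R$, $q(\bigvee_i t_i,\bigvee_j t'_j)=\bigvee_{k\in\mathbb{N}}q(t_k,t'_k)$. Assume further that for all sets $X,Y$, all coalgebras $c\colon X\to F_S(X)$, $d\colon Y\to F_R(Y)$ and all $k\in\mathbb{N}$, with $u_{S,k}:=(\Phi_{\tau_S,c})^k(\bot)\colon X\to\Omega_S$ and $u_{R,k}:=(\Phi_{\tau_R,d})^k(\bot)\colon Y\to\Omega_R$, $$q\circ(\tau_S\times\tau_R)\circ(F_S(u_{S,k})\times F_R(u_{R,k}))=\tau_{S\otimes R}\circ F_{S\otimes R}(q)\circ\lambda_{\Omega_S,\Omega_R}\circ(F_S(u_{S,k})\times F_R(u_{R,k}))$$ as maps $F_S(X)\times F_R(Y)\to\Omega_{S\otimes R}$. Then for all coalgebras $c\colon X\to F_S(X)$ and $d\colon Y\to F_R(Y)$, $[\![c\otimes_\lambda d]\!]=q\circ([\![c]\!]\times[\![d]\!])$.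
   Context: All functors are endofunctors on the category of sets. A coalgebra for $F$ with state set $X$ is a map $c\colon X\to F(X)$. An $\omega$-cpo is a poset with least element $\bot$ in which every increasing sequence has a supremum. A semantic structure for $F$ is an $\omega$-cpo $(\Omega,\preceq)$ with a map $\tau\colon F(\Omega)\to\Omega$. For a coalgebra $c$, $\Phi_{\tau,c}\colon\Omega^X\to\Omega^X$ is $\Phi_{\tau,c}(u)=\tau\circ F(u)\circ c$, with $\Omega^X$ ordered pointwise and $\bot$ the constant least map; as a standing assumption all such predicate transformers are $\omega$-continuous. The semantics $[\![c]\!]\colon X\to\Omega$ is the least fixed point of $\Phi_{\tau,c}$. A distributive law $\lambda$ from $F_S$ and $F_R$ to $F_{S\otimes R}$ is a family $\lambda_{X,Y}\colon F_S(X)\times F_R(Y)\to F_{S\otimes R}(X\times Y)$ natural in $X$ and $Y$. The coalgebraic product is $c\otimes_\lambda d=\lambda_{X,Y}\circ(c\times d)\colon X\times Y\to F_{S\otimes R}(X\times Y)$, and $[\![c]\!],[\![d]\!],[\![c\otimes_\lambda d]\!]$ are computed with $\tau_S,\tau_R,\tau_{S\otimes R}$ respectively. -}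

module Defs where

open import Data.Nat using (ℕ; zero; suc)
open import Data.Product using (_×_; _,_; proj₁; proj₂)
open import Relation.Binary.PropositionalEquality using (_≡_)
open import Function using (id; _∘_)

-- Endofunctors on the category of sets (Agda's Set), with the functor laws
-- stated pointwise (there is no function extensionality).  `fmap-ext` says
-- that fmap respects extensional equality of maps, which holds for every
-- functor on sets since equal functions are pointwise equal.
record Functor : Set₁ where
  field
    F        : Set → Set
    fmap     : {A B : Set} → (A → B) → F A → F B
    fmap-ext : {A B : Set} {f g : A → B} → (∀ a → f a ≡ g a) → ∀ z → fmap f z ≡ fmap g z
    fmap-id  : {A : Set} (z : F A) → fmap id z ≡ z
    fmap-∘   : {A B C : Set} (g : B → C) (f : A → B) (z : F A) → fmap (g ∘ f) z ≡ fmap g (fmap f z)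
open Functor public

IsLub : {Ω : Set} (_≤_ : Ω → Ω → Set) → Ω → (ℕ → Ω) → Set
IsLub _≤_ s u = (∀ i → u i ≤ s) × (∀ b → (∀ i → u i ≤ b) → s ≤ b)

record ωCPO : Set₁ where
  field
    Carrier  : Set
    _≤_      : Carrier → Carrier → Set
    ≤-refl   : ∀ a → a ≤ a
    ≤-trans  : ∀ {a b c} → a ≤ b → b ≤ c → a ≤ c
    ≤-antisym : ∀ {a b} → a ≤ b → b ≤ a → a ≡ b
    ⊥        : Carrier
    ⊥-least  : ∀ a → ⊥ ≤ a
    ⋁        : (u : ℕ → Carrier) → (∀ i → u i ≤ u (suc i)) → Carrier
    ⋁-lub    : (u : ℕ → Carrier) (inc : ∀ i → u i ≤ u (suc i)) → IsLub _≤_ (⋁ u inc) u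
open ωCPO public

record SemStruct (Fn : Functor) : Set₁ where
  field
    Ω : ωCPO
    τ : F Fn (Carrier Ω) → Carrier Ω
open SemStruct public

module _ {Fn : Functor} (S : SemStruct Fn) where
  private
    O = Ω S

  Φ : {X : Set} → (X → F Fn X) → (X → Carrier O) → (X → Carrier O)
  Φ c u = τ S ∘ fmap Fn u ∘ c

  ⊥map : {X : Set} → X → Carrier O
  ⊥map _ = ⊥ O

  Φiter : {X : Set} → (X → F Fn X) → ℕ → X → Carrier O
  Φiter c zero    = ⊥map
  Φiter c (suc k) = Φ c (Φiter c k)

  ωContinuous : {X : Set} → (X → F Fn X) → Set
  ωContinuous {X} c =
    (u : ℕ → X → Carrier O) (inc : ∀ i x → _≤_ O (u i x) (u (suc i) x)) →
    ∀ x → IsLub (_≤_ O) (Φ c (λ y → ⋁ O (λ i → u i y) (λ i → inc i y)) x) (λ i → Φ c (u i) x)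

  -- standing assumption: all predicate transformers are ω-continuous
  AllContinuous : Set₁
  AllContinuous = {X : Set} (c : X → F Fn X) → ωContinuous c

  IsSemantics : {X : Set} → (X → F Fn X) → (X → Carrier O) → Set
  IsSemantics {X} c s =
    (∀ x → Φ c s x ≡ s x) ×
    ((v : X → Carrier O) → (∀ x → Φ c v x ≡ v x) → ∀ x → _≤_ O (s x) (v x))

record DistLaw (FS FR FSR : Functor) : Set₁ where
  field
    law : {X Y : Set} → F FS X × F FR Y → F FSR (X × Y)
    natural : {X X' Y Y' : Set} (f : X → X') (g : Y → Y') (a : F FS X) (b : F FR Y) →
              law (fmap FS f a , fmap FR g b) ≡ fmap FSR (λ p → f (proj₁ p) , g (proj₂ p)) (law (a , b))
open DistLaw public

coprod : {FS FR FSR : Functor} → DistLaw FS FR FSR →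
         {X Y : Set} → (X → F FS X) → (Y → F FR Y) → X × Y → F FSR (X × Y)
coprod L c d (x , y) = law L (c x , d y)

{-# OPTIONS --safe #-}
module Submission where

-- By Kleene's fixed point theorem the semantics of a coalgebra is the pointwise
-- supremum of the iterates Φᵏ(⊥).  The hypothesis on q and λ says that q commutes
-- with one application of the predicate transformers, so by induction the k-th
-- iterate for c ⊗_λ d is q applied to the k-th iterates for c and d; since q
-- preserves suprema of ω-chains, the two semantics agree.

open import Defs
open import Data.Nat using (ℕ; zero; suc)
open import Data.Product using (_×_; _,_; proj₁; proj₂)
open import Function using (_∘′_)
open import Relation.Binary.PropositionalEquality
  using (_≡_; sym; cong; cong₂; subst; module ≡-Reasoning)

module _ (C : ωCPO) where

  IsLub-unique : {a b : Carrier C} {u : ℕ → Carrier C} →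
                 IsLub (_≤_ C) a u → IsLub (_≤_ C) b u → a ≡ b
  IsLub-unique (a-ub , a-least) (b-ub , b-least) =
    ≤-antisym C (a-least _ b-ub) (b-least _ a-ub)

  IsLub-cong : {a : Carrier C} {u v : ℕ → Carrier C} → (∀ i → u i ≡ v i) →
               IsLub (_≤_ C) a u → IsLub (_≤_ C) a v
  IsLub-cong {a} u≡v (ub , least) =
    (λ i → subst (λ z → _≤_ C z a) (u≡v i) (ub i)) ,
    (λ b v≤b → least b (λ i → subst (λ z → _≤_ C z b) (sym (u≡v i)) (v≤b i)))

module Kleene {Fn : Functor} (S : SemStruct Fn) (cont : AllContinuous S)
              {X : Set} (c : X → F Fn X) where

  private
    O = Ω S
    _⊑_ : Carrier O → Carrier O → Set
    _⊑_ = _≤_ O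

  Φ-cong : {u v : X → Carrier O} → (∀ x → u x ≡ v x) → ∀ x → Φ S c u x ≡ Φ S c v x
  Φ-cong u≡v x = cong (τ S) (fmap-ext Fn u≡v (c x))

  -- Continuity applied to the chain u, v, v, … , whose supremum is v.
  Φ-mono : {u v : X → Carrier O} → (∀ x → u x ⊑ v x) → ∀ x → Φ S c u x ⊑ Φ S c v x
  Φ-mono {u} {v} u⊑v x =
    subst (Φ S c u x ⊑_) (Φ-cong ⋁chain≡v x) (proj₁ (cont c chain chain-inc x) 0)
    where
    chain : ℕ → X → Carrier O
    chain zero    = u
    chain (suc _) = v

    chain⊑v : ∀ i y → chain i y ⊑ v y
    chain⊑v zero    y = u⊑v y
    chain⊑v (suc _) y = ≤-refl O (v y)

    chain-inc : ∀ i y → chain i y ⊑ chain (suc i) y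
    chain-inc = chain⊑v

    ⋁chain≡v : ∀ y → ⋁ O (λ i → chain i y) (λ i → chain-inc i y) ≡ v y
    ⋁chain≡v y = ≤-antisym O (proj₂ lub (v y) (λ i → chain⊑v i y)) (proj₁ lub 1)
      where lub = ⋁-lub O (λ i → chain i y) (λ i → chain-inc i y)

  Φiter-inc : ∀ k x → Φiter S c k x ⊑ Φiter S c (suc k) x
  Φiter-inc zero    x = ⊥-least O _
  Φiter-inc (suc k) x = Φ-mono (Φiter-inc k) x

  lfp : X → Carrier O
  lfp x = ⋁ O (λ k → Φiter S c k x) (λ k → Φiter-inc k x)

  lfp-isLub : ∀ x → IsLub _⊑_ (lfp x) (λ k → Φiter S c k x)
  lfp-isLub x = ⋁-lub O (λ k → Φiter S c k x) (λ k → Φiter-inc k x)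

  lfp-fixed : ∀ x → Φ S c lfp x ≡ lfp x
  lfp-fixed x = IsLub-unique O (cont c (Φiter S c) Φiter-inc x) (ub , least)
    where
    ub : ∀ k → Φiter S c (suc k) x ⊑ lfp x
    ub k = proj₁ (lfp-isLub x) (suc k)

    least : ∀ b → (∀ k → Φiter S c (suc k) x ⊑ b) → lfp x ⊑ b
    least b iter⊑b = proj₂ (lfp-isLub x) b iter'⊑b
      where
      iter'⊑b : ∀ k → Φiter S c k x ⊑ b
      iter'⊑b zero    = ⊥-least O b
      iter'⊑b (suc k) = iter⊑b k

  Φiter⊑fixedPoint : (v : X → Carrier O) → (∀ x → Φ S c v x ≡ v x) →
                     ∀ k x → Φiter S c k x ⊑ v x
  Φiter⊑fixedPoint v fixed zero    x = ⊥-least O (v x)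
  Φiter⊑fixedPoint v fixed (suc k) x =
    subst (Φiter S c (suc k) x ⊑_) (fixed x) (Φ-mono (Φiter⊑fixedPoint v fixed k) x)

  semantics≡lfp : {s : X → Carrier O} → IsSemantics S c s → ∀ x → s x ≡ lfp x
  semantics≡lfp {s} (fixed , least) x =
    ≤-antisym O (least lfp lfp-fixed x)
                (proj₂ (lfp-isLub x) (s x) (λ k → Φiter⊑fixedPoint s fixed k x))

  semantics-isLub : {s : X → Carrier O} → IsSemantics S c s →
                    ∀ x → IsLub _⊑_ (s x) (λ k → Φiter S c k x)
  semantics-isLub sem x =
    subst (λ z → IsLub _⊑_ z (λ k → Φiter S c k x)) (sym (semantics≡lfp sem x)) (lfp-isLub x)

module _ {FS FR FSR : Functor} {S : SemStruct FS} {R : SemStruct FR} {T : SemStruct FSR}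
         (L : DistLaw FS FR FSR) (q : Carrier (Ω S) × Carrier (Ω R) → Carrier (Ω T))
         (q-⊥ : q (⊥ (Ω S) , ⊥ (Ω R)) ≡ ⊥ (Ω T))
         {X Y : Set} (c : X → F FS X) (d : Y → F FR Y) where

  Φiter-coprod :
    (∀ k a b → q (τ S (fmap FS (Φiter S c k) a) , τ R (fmap FR (Φiter R d k) b))
               ≡ τ T (fmap FSR q (law L (fmap FS (Φiter S c k) a , fmap FR (Φiter R d k) b)))) →
    ∀ k x y → Φiter T (coprod L c d) k (x , y) ≡ q (Φiter S c k x , Φiter R d k y)
  Φiter-coprod q-τ zero    x y = sym q-⊥
  Φiter-coprod q-τ (suc k) x y = begin
      τ T (fmap FSR (Φiter T (coprod L c d) k) (law L (c x , d y)))
    ≡⟨ cong (τ T) (fmap-ext FSR (λ (x' , y') → Φiter-coprod q-τ k x' y') (law L (c x , d y))) ⟩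
      τ T (fmap FSR (λ p → q (uₖ×vₖ p)) (law L (c x , d y)))
    ≡⟨ cong (τ T) (fmap-∘ FSR q uₖ×vₖ (law L (c x , d y))) ⟩
      τ T (fmap FSR q (fmap FSR uₖ×vₖ (law L (c x , d y))))
    ≡⟨ cong (τ T ∘′ fmap FSR q) (sym (natural L (Φiter S c k) (Φiter R d k) (c x) (d y))) ⟩
      τ T (fmap FSR q (law L (fmap FS (Φiter S c k) (c x) , fmap FR (Φiter R d k) (d y))))
    ≡⟨ sym (q-τ k (c x) (d y)) ⟩
      q (Φiter S c (suc k) x , Φiter R d (suc k) y)
    ∎
    where
    open ≡-Reasoning
    uₖ×vₖ : X × Y → Carrier (Ω S) × Carrier (Ω R)
    uₖ×vₖ (x' , y') = Φiter S c k x' , Φiter R d k y'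

proposition4p9 :
  (FS FR FSR : Functor) (S : SemStruct FS) (R : SemStruct FR) (T : SemStruct FSR) →
  AllContinuous S → AllContinuous R → AllContinuous T →
  (L : DistLaw FS FR FSR) →
  (q : Carrier (Ω S) × Carrier (Ω R) → Carrier (Ω T)) →
  q (⊥ (Ω S) , ⊥ (Ω R)) ≡ ⊥ (Ω T) →
  ((t : ℕ → Carrier (Ω S)) (it : ∀ i → _≤_ (Ω S) (t i) (t (suc i))) →
   (t' : ℕ → Carrier (Ω R)) (it' : ∀ i → _≤_ (Ω R) (t' i) (t' (suc i))) →
   IsLub (_≤_ (Ω T)) (q (⋁ (Ω S) t it , ⋁ (Ω R) t' it')) (λ k → q (t k , t' k))) →
  ({X Y : Set} (c : X → F FS X) (d : Y → F FR Y) (k : ℕ) (a : F FS X) (b : F FR Y) →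
   q (τ S (fmap FS (Φiter S c k) a) , τ R (fmap FR (Φiter R d k) b))
     ≡ τ T (fmap FSR q (law L (fmap FS (Φiter S c k) a , fmap FR (Φiter R d k) b)))) →
  {X Y : Set} (c : X → F FS X) (d : Y → F FR Y) →
  (sc : X → Carrier (Ω S)) (sd : Y → Carrier (Ω R)) (s : X × Y → Carrier (Ω T)) →
  IsSemantics S c sc → IsSemantics R d sd → IsSemantics T (coprod L c d) s →
  ∀ x y → s (x , y) ≡ q (sc x , sd y)
proposition4p9 FS FR FSR S R T cont-S cont-R cont-T L q q-⊥ q-⋁ q-τ c d sc sd s sem-c sem-d sem-cd x y =
  begin
    s (x , y)
  ≡⟨ IsLub-unique (Ω T) (KT.semantics-isLub sem-cd (x , y)) lub-of-q-iterates ⟩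
    q (KS.lfp x , KR.lfp y)
  ≡⟨ sym (cong₂ (λ a b → q (a , b)) (KS.semantics≡lfp sem-c x) (KR.semantics≡lfp sem-d y)) ⟩
    q (sc x , sd y)
  ∎
  where
  open ≡-Reasoning
  module KS = Kleene S cont-S c
  module KR = Kleene R cont-R d
  module KT = Kleene T cont-T (coprod L c d)

  lub-of-q-iterates : IsLub (_≤_ (Ω T)) (q (KS.lfp x , KR.lfp y))
                            (λ k → Φiter T (coprod L c d) k (x , y))
  lub-of-q-iterates =
    IsLub-cong (Ω T) (λ k → sym (Φiter-coprod L q q-⊥ c d (q-τ c d) k x y))
      (q-⋁ (λ k → Φiter S c k x) (λ k → KS.Φiter-inc k x)
           (λ k → Φiter R d k y) (λ k → KR.Φiter-inc k y))
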